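{- For every $n\ge1$, $\displaystyle R_{n+1}=R_nR_1+\sum_{i=1}^{n}R_{n-i}\widetilde R_{i+1}$.
   Context: Let $q\ge 4$ be an integer and consider the regular square mosaic $\{4,q\}$ (Schläfli symbol), i.e. the tiling of the Euclidean plane ($q=4$) or of the hyperbolic plane ($q\ge5$) by congruent regular squares with $q$ squares around each vertex. For $n\ge1$ the $(2\times n)$-board is defined as follows. Choose a square $S_1$ of the mosaic with vertices $A_0,A_1,B_1,B_0$ in cyclic order. Inductively, for $i\ge1$ let $S_{i+1}$ be the other square of the mosaic containing the edge $A_iB_i$, with vertices $A_i,A_{i+1},B_{i+1},B_i$ in cyclic order. The first level of the board consists of $S_1,\dots,S_n$; the second level consists of all squares of the mosaic having at least one vertex in $\{A_1,\dots,A_n\}$ and no vertex in $\{B_1,\dots,B_n,A_{n+1}\}$ (here $A_{n+1}$ is the vertex of $S_{n+1}$). The board is the union of both levels. For $1\le j\le n$ the $j$-th column consists of $S_j$ together with the second-level squares that contain $A_j$ but not $A_{j+1}$. A domino is a pair of squares of the board sharing an edge. Given positive integers $a,b$, a colored tiling is a partition of the squares of the board into single squares and dominoes, each single square receiving one of $a$ colors and each domino one of $b$ colors. A tiling is breakable in position $i$ ($1\le i\le n-1$) if no domino contains a square of the first $i$ columns and a square of the remaining columns; it is unbreakable if it is breakable in no position. $R_n$ is the number of colored tilings of the $(2\times n)$-board ($R_0=1$) and $\widetilde R_n$ the number of unbreakable colored tilings of it. -}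

module Defs where

open import Data.Nat using (ℕ; zero; suc; _+_; _*_; _∸_; _^_; _≡ᵇ_; _<ᵇ_)
open import Data.Bool using (Bool; true; false; _∧_; _∨_; not; _xor_; if_then_else_)
open import Data.List using (List; []; _∷_; _++_; map; concatMap; upTo; sum; length; all; any; filterᵇ; [_])
open import Data.Product using (_×_; _,_)

-- Combinatorial model of the (2×n)-board of the mosaic {4,q}.
-- Columns are numbered 0..n-1 (column j here = column j+1 of the paper).
-- Let m = q ∸ 3.  Column j consists of the first-level square  S j
-- (= S_{j+1} of the paper) and m second-level squares  L j 0 , … , L j (m-1):
--   L j 0      = the square across the edge A_j A_{j+1} from S_{j+1}
--                (paper indices; it contains A_j and A_{j+1}),
--   L j 1 …    = the q-4 further squares around the vertex A_{j+1}
--                containing no other A-vertex, listed going around A_{j+1}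
--                from L j 0 towards the square L (j+1) 0.
-- Edge-adjacent pairs of board squares (dominoes):
--   S j — S (j+1) ;  S j — L j 0 ;  L j t — L j (t+1) ;  L j (m-1) — L (j+1) 0.

data Sq : Set where
  S : ℕ → Sq
  L : ℕ → ℕ → Sq

_==_ : Sq → Sq → Bool
S i   == S j   = i ≡ᵇ j
S _   == L _ _ = false
L _ _ == S _   = false
L i s == L j t = (i ≡ᵇ j) ∧ (s ≡ᵇ t)

col : Sq → ℕ
col (S j)   = j
col (L j _) = j

Edge : Set
Edge = Sq × Sq

squares : ℕ → ℕ → List Sq
squares q n = map S (upTo n) ++ concatMap (λ j → map (L j) (upTo (q ∸ 3))) (upTo n)

edges : ℕ → ℕ → List Edge
edges q n =
  map (λ i → S i , S (suc i)) (upTo (n ∸ 1))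
  ++ map (λ j → S j , L j 0) (upTo n)
  ++ concatMap (λ j → map (λ t → L j t , L j (suc t)) (upTo (q ∸ 3 ∸ 1))) (upTo n)
  ++ map (λ j → L j (q ∸ 3 ∸ 1) , L (suc j) 0) (upTo (n ∸ 1))

sublists : {A : Set} → List A → List (List A)
sublists []       = [ [] ]
sublists (x ∷ xs) = sublists xs ++ map (x ∷_) (sublists xs)

count : {A : Set} → (A → Bool) → List A → ℕ
count p xs = length (filterᵇ p xs)

incident : Sq → Edge → Bool
incident s (u , v) = (s == u) ∨ (s == v)

-- a set of dominoes is (the domino part of) a tiling iff every square lies
-- in at most one domino; the remaining squares are the single squares
isTiling : ℕ → ℕ → List Edge → Bool
isTiling q n M = all (λ s → count (incident s) M <ᵇ 2) (squares q n)

crosses : ℕ → Edge → Bool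
crosses i (u , v) = (col u <ᵇ i) xor (col v <ᵇ i)

-- breakable in position i (paper's position i, 1 ≤ i ≤ n-1)
breakable : List Edge → ℕ → Bool
breakable M i = not (any (crosses i) M)

unbreakable : ℕ → List Edge → Bool
unbreakable n M = all (λ k → not (breakable M (suc k))) (upTo (n ∸ 1))

-- number of colourings of a tiling with domino set M:
-- a colours for each single square, b colours for each domino
colourings : ℕ → ℕ → ℕ → ℕ → List Edge → ℕ
colourings q a b n M = a ^ (length (squares q n) ∸ 2 * length M) * b ^ length M

tilings : ℕ → ℕ → List (List Edge)
tilings q n = filterᵇ (isTiling q n) (sublists (edges q n))

R : ℕ → ℕ → ℕ → ℕ → ℕ
R q a b n = sum (map (colourings q a b n) (tilings q n))

R̃ : ℕ → ℕ → ℕ → ℕ → ℕ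
R̃ q a b n = sum (map (colourings q a b n) (filterᵇ (unbreakable n) (tilings q n)))

-- Classify the tilings of the (n+1)-board by their first break. Either the tiling is
-- unbreakable, or it breaks at a least position j + 1 ≤ n; then it is breakable there. Hence
--   R (n+1) = R̃ (n+1) + Σ_{j<n} R̃ (j+1) · R (n−j),
-- and the stated form follows by splitting off the term j = 0, where R̃ 1 = R 1, and
-- reindexing.

module Submission where

open import Defs
import Algebra.Properties.CommutativeSemigroup
open import Data.Bool using (Bool; true; false; _∧_; _∨_; _xor_; not; if_then_else_)
open import Data.Bool.Properties
  using (∧-assoc; ∨-assoc; ∧-identityʳ; ∨-identityʳ; ∧-zeroʳ; ∨-zeroʳ; ∧-isCommutativeMonoid; ∨-isCommutativeMonoid)
open import Data.Bool.ListAction using (all; any)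
open import Data.List using (List; []; _∷_; _++_; _∷ʳ_; [_]; map; foldr; concat; concatMap; upTo; applyUpTo; length; filterᵇ)
open import Data.List.Properties
  using (++-assoc; length-++; length-map; map-++; map-∘; map-cong; map-upTo; upTo-∷ʳ; concat-++; map-concatMap; concatMap-cong)
open import Data.List.Relation.Binary.Permutation.Propositional as ↭ using (_↭_; ↭⇒↭ₛ; module PermutationReasoning)
open import Data.List.Relation.Binary.Permutation.Propositional.Properties using (map⁺; ++⁺ˡ; shift; shifts; ↭-length)
open import Data.List.Relation.Binary.Permutation.Setoid.Properties using (foldr-commMonoid)
open import Data.List.Relation.Unary.All as All using (All; []; _∷_; universal)
open import Data.List.Relation.Unary.All.Properties using (++⁺; concat⁺; applyUpTo⁺₁)
open import Data.List.Membership.Propositional.Properties using (∈-map⁺; ∈-++⁺ˡ; ∈-++⁺ʳ; ∈-concat⁺′; ∈-upTo⁺)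
open import Data.List.Relation.Unary.Any using (here; there)
open import Data.List.Membership.Propositional using (_∈_)
open import Data.Empty using (⊥-elim)
open import Data.Nat using (ℕ; zero; suc; _+_; _*_; _^_; _∸_; _≤_; _<_; _≡ᵇ_; _<ᵇ_; z≤n; s≤s)
open import Data.Nat.ListAction using (sum)
open import Data.Nat.Tactic.RingSolver using (solve-∀)
open import Data.Nat.ListAction.Properties using (sum-++; sum-↭)
open import Data.Nat.Properties
  using (≤-refl; ≤-reflexive; ≤-trans; <-≤-trans; <⇒≤; <⇒≢; ≤-pred; n≤1+n; n<1+n; m≤m+n; +-mono-≤; m≤n⇒∃[o]m+o≡n
        ; +-identityʳ; +-suc; *-identityˡ; *-zeroʳ; *-suc; *-comm; *-distribˡ-+; *-distribʳ-+; ^-distribˡ-+-*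
        ; n∸n≡0; m+n∸m≡n; ∸-+-assoc; +-∸-comm; +-∸-assoc; ∸-monoˡ-≤
        ; +-commutativeSemigroup; *-commutativeSemigroup; module ≤-Reasoning)
open import Data.Product using (_×_; _,_; proj₁; proj₂)
open import Function using (_∘_; id)
open import Relation.Binary.PropositionalEquality using (_≡_; _≢_; refl; sym; trans; cong; cong₂; subst; setoid; module ≡-Reasoning)

private
  module +-CS = Algebra.Properties.CommutativeSemigroup +-commutativeSemigroup
  module *-CS = Algebra.Properties.CommutativeSemigroup *-commutativeSemigroup

private
  variable
    A B : Set

≡ᵇ-refl : ∀ n → (n ≡ᵇ n) ≡ true
≡ᵇ-refl zero    = refl
≡ᵇ-refl (suc n) = ≡ᵇ-refl n

≢⇒≡ᵇ≡false : ∀ {m n} → m ≢ n → (m ≡ᵇ n) ≡ false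
≢⇒≡ᵇ≡false {zero}  {zero}  m≢n = ⊥-elim (m≢n refl)
≢⇒≡ᵇ≡false {zero}  {suc n} _   = refl
≢⇒≡ᵇ≡false {suc m} {zero}  _   = refl
≢⇒≡ᵇ≡false {suc m} {suc n} m≢n = ≢⇒≡ᵇ≡false (m≢n ∘ cong suc)

≡ᵇ-+ˡ : ∀ p m n → (p + m ≡ᵇ p + n) ≡ (m ≡ᵇ n)
≡ᵇ-+ˡ zero    m n = refl
≡ᵇ-+ˡ (suc p) m n = ≡ᵇ-+ˡ p m n

<⇒<ᵇ≡true : ∀ {m n} → m < n → (m <ᵇ n) ≡ true
<⇒<ᵇ≡true {zero}  {suc n} _         = refl
<⇒<ᵇ≡true {suc m} {suc n} (s≤s m<n) = <⇒<ᵇ≡true m<n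

≤⇒<ᵇ≡false : ∀ {m n} → n ≤ m → (m <ᵇ n) ≡ false
≤⇒<ᵇ≡false {m}     {zero}  _         = refl
≤⇒<ᵇ≡false {suc m} {suc n} (s≤s n≤m) = ≤⇒<ᵇ≡false n≤m

<ᵇ≡true⇒< : ∀ {m n} → (m <ᵇ n) ≡ true → m < n
<ᵇ≡true⇒< {zero}  {suc n} _ = s≤s z≤n
<ᵇ≡true⇒< {suc m} {suc n} m<ᵇn = s≤s (<ᵇ≡true⇒< m<ᵇn)

[m+n]∸[o+r]≡[m∸o]+[n∸r] : ∀ m n {o r} → o ≤ m → r ≤ n → (m + n) ∸ (o + r) ≡ (m ∸ o) + (n ∸ r)
[m+n]∸[o+r]≡[m∸o]+[n∸r] m n {o} {r} o≤m r≤n = begin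
  (m + n) ∸ (o + r)    ≡⟨ ∸-+-assoc (m + n) o r ⟨
  (m + n) ∸ o ∸ r      ≡⟨ cong (_∸ r) (+-∸-comm n o≤m) ⟩
  (m ∸ o + n) ∸ r      ≡⟨ +-∸-assoc (m ∸ o) r≤n ⟩
  (m ∸ o) + (n ∸ r)    ∎
  where open ≡-Reasoning

-- Indicators and sums over lists

toℕ : Bool → ℕ
toℕ b = if b then 1 else 0

toℕ-∧ : ∀ x y → toℕ (x ∧ y) ≡ toℕ x * toℕ y
toℕ-∧ false y = refl
toℕ-∧ true  y = sym (+-identityʳ (toℕ y))

toℕ-∧-*-cong : ∀ b c {x y} → (b ≡ true → c ≡ true → x ≡ y) → toℕ (b ∧ c) * x ≡ toℕ (b ∧ c) * y
toℕ-∧-*-cong false c     _   = refl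
toℕ-∧-*-cong true  false _   = refl
toℕ-∧-*-cong true  true  x≡y = cong (_+ 0) (x≡y refl refl)

∑ : List A → (A → ℕ) → ℕ
∑ xs f = sum (map f xs)

syntax ∑ xs (λ x → e) = ∑[ x ∈ xs ] e

∑-++ : ∀ xs ys (f : A → ℕ) → ∑ (xs ++ ys) f ≡ ∑ xs f + ∑ ys f
∑-++ xs ys f = trans (cong sum (map-++ f xs ys)) (sum-++ (map f xs) (map f ys))

∑-map : ∀ (g : B → A) xs (f : A → ℕ) → ∑ (map g xs) f ≡ ∑ xs (f ∘ g)
∑-map g xs f = cong sum (sym (map-∘ xs))

∑-cong : ∀ xs {f g : A → ℕ} → (∀ x → f x ≡ g x) → ∑ xs f ≡ ∑ xs g
∑-cong xs f≗g = cong sum (map-cong f≗g xs)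

∑-congᴬ : ∀ {P : A → Set} {xs} {f g : A → ℕ} → All P xs → (∀ {x} → P x → f x ≡ g x) → ∑ xs f ≡ ∑ xs g
∑-congᴬ []         _   = refl
∑-congᴬ (px ∷ pxs) f≗g = cong₂ _+_ (f≗g px) (∑-congᴬ pxs f≗g)

∑-zero : ∀ {xs} {f : A → ℕ} → All (λ x → f x ≡ 0) xs → ∑ xs f ≡ 0
∑-zero []           = refl
∑-zero (fx≡0 ∷ f≡0) = cong₂ _+_ fx≡0 (∑-zero f≡0)

∑-+ : ∀ xs (f g : A → ℕ) → ∑[ x ∈ xs ] (f x + g x) ≡ ∑ xs f + ∑ xs g
∑-+ []       f g = refl
∑-+ (x ∷ xs) f g = trans (cong (f x + g x +_) (∑-+ xs f g)) (+-CS.interchange (f x) (g x) _ _)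

∑-*ˡ : ∀ xs c (f : A → ℕ) → ∑[ x ∈ xs ] (c * f x) ≡ c * ∑ xs f
∑-*ˡ []       c f = sym (*-zeroʳ c)
∑-*ˡ (x ∷ xs) c f = trans (cong (c * f x +_) (∑-*ˡ xs c f)) (sym (*-distribˡ-+ c (f x) _))

∑-*ʳ : ∀ xs c (f : A → ℕ) → ∑[ x ∈ xs ] (f x * c) ≡ ∑ xs f * c
∑-*ʳ []       c f = refl
∑-*ʳ (x ∷ xs) c f = trans (cong (f x * c +_) (∑-*ʳ xs c f)) (sym (*-distribʳ-+ c (f x) _))

∑-comm : ∀ xs (ys : List B) (h : A → B → ℕ) → ∑[ x ∈ xs ] ∑ ys (h x) ≡ ∑[ y ∈ ys ] ∑[ x ∈ xs ] h x y
∑-comm []       ys h = sym (∑-zero (universal (λ _ → refl) ys))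
∑-comm (x ∷ xs) ys h = trans (cong (∑ ys (h x) +_) (∑-comm xs ys h)) (sym (∑-+ ys (h x) _))

∑-filterᵇ : ∀ (p : A → Bool) xs (f : A → ℕ) → ∑ (filterᵇ p xs) f ≡ ∑[ x ∈ xs ] (toℕ (p x) * f x)
∑-filterᵇ p []       f = refl
∑-filterᵇ p (x ∷ xs) f with p x
... | true  = cong₂ _+_ (sym (+-identityʳ (f x))) (∑-filterᵇ p xs f)
... | false = ∑-filterᵇ p xs f

*-length≤∑ : ∀ c {xs} {f : A → ℕ} → All (λ x → c ≤ f x) xs → c * length xs ≤ ∑ xs f
*-length≤∑ c {[]}     []           = ≤-reflexive (*-zeroʳ c)
*-length≤∑ c {x ∷ xs} (c≤fx ∷ c≤f) = ≤-trans (≤-reflexive (*-suc c (length xs))) (+-mono-≤ c≤fx (*-length≤∑ c c≤f))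

∑≤length : ∀ (f : A → ℕ) xs → all (λ x → f x <ᵇ 2) xs ≡ true → ∑ xs f ≤ length xs
∑≤length f []       _ = z≤n
∑≤length f (x ∷ xs) h with f x <ᵇ 2 in fx<2
... | true = +-mono-≤ (≤-pred (<ᵇ≡true⇒< fx<2)) (∑≤length f xs h)

count≡∑ : ∀ (p : A → Bool) xs → count p xs ≡ ∑ xs (toℕ ∘ p)
count≡∑ p []       = refl
count≡∑ p (x ∷ xs) with p x
... | true  = cong suc (count≡∑ p xs)
... | false = count≡∑ p xs

count-++ : ∀ (p : A → Bool) xs ys → count p (xs ++ ys) ≡ count p xs + count p ys
count-++ p xs ys = begin
  count p (xs ++ ys)                   ≡⟨ count≡∑ p (xs ++ ys) ⟩
  ∑ (xs ++ ys) (toℕ ∘ p)               ≡⟨ ∑-++ xs ys (toℕ ∘ p) ⟩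
  ∑ xs (toℕ ∘ p) + ∑ ys (toℕ ∘ p)      ≡⟨ cong₂ _+_ (count≡∑ p xs) (count≡∑ p ys) ⟨
  count p xs + count p ys              ∎
  where open ≡-Reasoning

count-map : ∀ (p : A → Bool) (f : B → A) xs → count p (map f xs) ≡ count (p ∘ f) xs
count-map p f xs = trans (count≡∑ p (map f xs)) (trans (∑-map f xs (toℕ ∘ p)) (sym (count≡∑ (p ∘ f) xs)))

count-cong : ∀ {p p′ : A → Bool} xs → (∀ x → p x ≡ p′ x) → count p xs ≡ count p′ xs
count-cong {p = p} {p′} xs p≗p′ = trans (count≡∑ p xs) (trans (∑-cong xs (cong toℕ ∘ p≗p′)) (sym (count≡∑ p′ xs)))

count-none : ∀ {p : A → Bool} {xs} → All (λ x → p x ≡ false) xs → count p xs ≡ 0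
count-none {p = p} {xs} none = trans (count≡∑ p xs) (∑-zero (All.map (cong toℕ) none))

count-↭ : ∀ (p : A → Bool) {xs ys} → xs ↭ ys → count p xs ≡ count p ys
count-↭ p {xs} {ys} xs↭ys = begin
  count p xs       ≡⟨ count≡∑ p xs ⟩
  ∑ xs (toℕ ∘ p)   ≡⟨ sum-↭ (map⁺ (toℕ ∘ p) xs↭ys) ⟩
  ∑ ys (toℕ ∘ p)   ≡⟨ count≡∑ p ys ⟨
  count p ys       ∎
  where open ≡-Reasoning

count-≥1 : ∀ (p : A → Bool) {x xs} → x ∈ xs → p x ≡ true → 1 ≤ count p xs
count-≥1 p {xs = y ∷ xs} (here refl) px with p y
... | true = s≤s z≤n
count-≥1 p {xs = y ∷ xs} (there x∈xs) px with p y
... | true  = s≤s z≤n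
... | false = count-≥1 p x∈xs px

count-≥2 : ∀ (p : A → Bool) {x y xs} → x ∈ xs → y ∈ xs → x ≢ y → p x ≡ true → p y ≡ true → 2 ≤ count p xs
count-≥2 p (here refl)  (here refl)  x≢y px py = ⊥-elim (x≢y refl)
count-≥2 p (here refl)  (there y∈xs) x≢y px py rewrite px = s≤s (count-≥1 p y∈xs py)
count-≥2 p (there x∈xs) (here refl)  x≢y px py rewrite py = s≤s (count-≥1 p x∈xs px)
count-≥2 p {xs = z ∷ xs} (there x∈xs) (there y∈xs) x≢y px py with p z
... | true  = ≤-trans (count-≥2 p x∈xs y∈xs x≢y px py) (n≤1+n _)
... | false = count-≥2 p x∈xs y∈xs x≢y px py

∑-count-comm : ∀ (r : A → B → Bool) xs ys → ∑[ y ∈ ys ] count (λ x → r x y) xs ≡ ∑[ x ∈ xs ] count (r x) ys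
∑-count-comm r xs ys = begin
  ∑[ y ∈ ys ] count (λ x → r x y) xs      ≡⟨ ∑-cong ys (λ y → count≡∑ (λ x → r x y) xs) ⟩
  ∑[ y ∈ ys ] ∑[ x ∈ xs ] toℕ (r x y)     ≡⟨ ∑-comm ys xs (λ y x → toℕ (r x y)) ⟩
  ∑[ x ∈ xs ] ∑[ y ∈ ys ] toℕ (r x y)     ≡⟨ ∑-cong xs (λ x → count≡∑ (r x) ys) ⟨
  ∑[ x ∈ xs ] count (r x) ys              ∎
  where open ≡-Reasoning

all-↭ : ∀ (p : A → Bool) {xs ys} → xs ↭ ys → all p xs ≡ all p ys
all-↭ p xs↭ys = foldr-commMonoid (setoid Bool) ∧-isCommutativeMonoid (↭⇒↭ₛ (map⁺ p xs↭ys))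

any-↭ : ∀ (p : A → Bool) {xs ys} → xs ↭ ys → any p xs ≡ any p ys
any-↭ p xs↭ys = foldr-commMonoid (setoid Bool) ∨-isCommutativeMonoid (↭⇒↭ₛ (map⁺ p xs↭ys))

all-++ : ∀ (p : A → Bool) xs ys → all p (xs ++ ys) ≡ all p xs ∧ all p ys
all-++ p []       ys = refl
all-++ p (x ∷ xs) ys = trans (cong (p x ∧_) (all-++ p xs ys)) (sym (∧-assoc (p x) _ _))

any-++ : ∀ (p : A → Bool) xs ys → any p (xs ++ ys) ≡ any p xs ∨ any p ys
any-++ p []       ys = refl
any-++ p (x ∷ xs) ys = trans (cong (p x ∨_) (any-++ p xs ys)) (sym (∨-assoc (p x) _ _))

all-map : ∀ (p : A → Bool) (g : B → A) xs → all p (map g xs) ≡ all (p ∘ g) xs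
all-map p g xs = cong (foldr _∧_ true) (sym (map-∘ xs))

any-map : ∀ (p : A → Bool) (g : B → A) xs → any p (map g xs) ≡ any (p ∘ g) xs
any-map p g xs = cong (foldr _∨_ false) (sym (map-∘ xs))

all-cong : ∀ {p p′ : A → Bool} xs → (∀ x → p x ≡ p′ x) → all p xs ≡ all p′ xs
all-cong xs p≗p′ = cong (foldr _∧_ true) (map-cong p≗p′ xs)

all-congᴬ : ∀ {P : A → Set} {xs} {p p′ : A → Bool} → All P xs → (∀ {x} → P x → p x ≡ p′ x) → all p xs ≡ all p′ xs
all-congᴬ []         _    = refl
all-congᴬ (px ∷ pxs) p≗p′ = cong₂ _∧_ (p≗p′ px) (all-congᴬ pxs p≗p′)

any-false : ∀ {xs} {p : A → Bool} → All (λ x → p x ≡ false) xs → any p xs ≡ false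
any-false []           = refl
any-false (px≡f ∷ p≡f) = cong₂ _∨_ px≡f (any-false p≡f)

any-crossed : ∀ (p : A → Bool) xs x ys → p x ≡ true → any p (xs ++ x ∷ ys) ≡ true
any-crossed p xs x ys px = trans (any-++ p xs (x ∷ ys)) (trans (cong (λ b → any p xs ∨ (b ∨ any p ys)) px) (∨-zeroʳ _))

-- Sums over sublists

∑⊆ : List A → (List A → ℕ) → ℕ
∑⊆ E f = ∑ (sublists E) f

syntax ∑⊆ E (λ M → e) = ∑[ M ⊆ E ] e

∑⊆-∷ : ∀ x xs (f : List A → ℕ) → ∑⊆ (x ∷ xs) f ≡ ∑⊆ xs f + ∑[ s ⊆ xs ] f (x ∷ s)
∑⊆-∷ x xs f = trans (∑-++ (sublists xs) _ f) (cong (∑⊆ xs f +_) (∑-map (x ∷_) (sublists xs) f))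

∑⊆-∷-vanishing : ∀ x xs (f : List A → ℕ) → (∀ s → f (x ∷ s) ≡ 0) → ∑⊆ (x ∷ xs) f ≡ ∑⊆ xs f
∑⊆-∷-vanishing x xs f f≡0 = begin
  ∑⊆ (x ∷ xs) f                     ≡⟨ ∑⊆-∷ x xs f ⟩
  ∑⊆ xs f + ∑[ s ⊆ xs ] f (x ∷ s)   ≡⟨ cong (∑⊆ xs f +_) (∑-zero (universal f≡0 (sublists xs))) ⟩
  ∑⊆ xs f + 0                       ≡⟨ +-identityʳ _ ⟩
  ∑⊆ xs f                           ∎
  where open ≡-Reasoning

∑⊆-++ : ∀ xs ys (f : List A → ℕ) → ∑⊆ (xs ++ ys) f ≡ ∑[ s ⊆ xs ] ∑[ t ⊆ ys ] f (s ++ t)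
∑⊆-++ []       ys f = sym (+-identityʳ _)
∑⊆-++ (x ∷ xs) ys f = begin
  ∑⊆ (x ∷ xs ++ ys) f
    ≡⟨ ∑⊆-∷ x (xs ++ ys) f ⟩
  ∑⊆ (xs ++ ys) f + ∑[ s ⊆ xs ++ ys ] f (x ∷ s)
    ≡⟨ cong₂ _+_ (∑⊆-++ xs ys f) (∑⊆-++ xs ys (f ∘ (x ∷_))) ⟩
  ∑[ s ⊆ xs ] ∑[ t ⊆ ys ] f (s ++ t) + ∑[ s ⊆ xs ] ∑[ t ⊆ ys ] f (x ∷ s ++ t)
    ≡⟨ ∑⊆-∷ x xs (λ s → ∑[ t ⊆ ys ] f (s ++ t)) ⟨
  ∑[ s ⊆ x ∷ xs ] ∑[ t ⊆ ys ] f (s ++ t)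
    ∎
  where open ≡-Reasoning

∑⊆-map : ∀ (g : B → A) E (f : List A → ℕ) → ∑⊆ (map g E) f ≡ ∑[ s ⊆ E ] f (map g s)
∑⊆-map g E f = trans (cong (λ S → ∑ S f) (sublists-map E)) (∑-map (map g) (sublists E) f)
  where
  sublists-map : ∀ xs → sublists (map g xs) ≡ map (map g) (sublists xs)
  sublists-map []       = refl
  sublists-map (x ∷ xs) = begin
    sublists (map g xs) ++ map (g x ∷_) (sublists (map g xs))
      ≡⟨ cong (λ S → S ++ map (g x ∷_) S) (sublists-map xs) ⟩
    map (map g) (sublists xs) ++ map (g x ∷_) (map (map g) (sublists xs))
      ≡⟨ cong (map (map g) (sublists xs) ++_) (trans (sym (map-∘ (sublists xs))) (map-∘ (sublists xs))) ⟩
    map (map g) (sublists xs) ++ map (map g) (map (x ∷_) (sublists xs))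
      ≡⟨ map-++ (map g) (sublists xs) _ ⟨
    map (map g) (sublists xs ++ map (x ∷_) (sublists xs))
      ∎
    where open ≡-Reasoning

∑⊆-congᴬ : ∀ {P : A → Set} {E} {f g : List A → ℕ} → All P E → (∀ {s} → All P s → f s ≡ g s) → ∑⊆ E f ≡ ∑⊆ E g
∑⊆-congᴬ [] f≗g = cong (_+ 0) (f≗g [])
∑⊆-congᴬ {E = x ∷ xs} {f} {g} (px ∷ pxs) f≗g = begin
  ∑⊆ (x ∷ xs) f                        ≡⟨ ∑⊆-∷ x xs f ⟩
  ∑⊆ xs f + ∑[ s ⊆ xs ] f (x ∷ s)      ≡⟨ cong₂ _+_ (∑⊆-congᴬ pxs f≗g) (∑⊆-congᴬ pxs (λ ps → f≗g (px ∷ ps))) ⟩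
  ∑⊆ xs g + ∑[ s ⊆ xs ] g (x ∷ s)      ≡⟨ ∑⊆-∷ x xs g ⟨
  ∑⊆ (x ∷ xs) g                        ∎
  where open ≡-Reasoning

∑⊆-↭ : ∀ {xs ys} (f : List A → ℕ) → (∀ {s t} → s ↭ t → f s ≡ f t) → xs ↭ ys → ∑⊆ xs f ≡ ∑⊆ ys f
∑⊆-↭ f f-inv ↭.refl = refl
∑⊆-↭ f f-inv (↭.prep {xs} {ys} x xs↭ys) = begin
  ∑⊆ (x ∷ xs) f                     ≡⟨ ∑⊆-∷ x xs f ⟩
  ∑⊆ xs f + ∑[ s ⊆ xs ] f (x ∷ s)   ≡⟨ cong₂ _+_ (∑⊆-↭ f f-inv xs↭ys) (∑⊆-↭ (f ∘ (x ∷_)) (f-inv ∘ ↭.prep x) xs↭ys) ⟩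
  ∑⊆ ys f + ∑[ s ⊆ ys ] f (x ∷ s)   ≡⟨ ∑⊆-∷ x ys f ⟨
  ∑⊆ (x ∷ ys) f                     ∎
  where open ≡-Reasoning
∑⊆-↭ f f-inv (↭.swap {xs} {ys} x y xs↭ys) = begin
  ∑⊆ (x ∷ y ∷ xs) f
    ≡⟨ trans (∑⊆-∷ x (y ∷ xs) f) (cong₂ _+_ (∑⊆-∷ y xs f) (∑⊆-∷ y xs (f ∘ (x ∷_)))) ⟩
  (∑⊆ xs f + ∑[ s ⊆ xs ] f (y ∷ s)) + (∑[ s ⊆ xs ] f (x ∷ s) + ∑[ s ⊆ xs ] f (x ∷ y ∷ s))
    ≡⟨ +-CS.interchange (∑⊆ xs f) (∑[ s ⊆ xs ] f (y ∷ s)) _ _ ⟩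
  (∑⊆ xs f + ∑[ s ⊆ xs ] f (x ∷ s)) + (∑[ s ⊆ xs ] f (y ∷ s) + ∑[ s ⊆ xs ] f (x ∷ y ∷ s))
    ≡⟨ cong₂ _+_ (cong₂ _+_ (∑⊆-↭ f f-inv xs↭ys) (∑⊆-↭ _ (f-inv ∘ ↭.prep x) xs↭ys))
                 (cong₂ _+_ (∑⊆-↭ _ (f-inv ∘ ↭.prep y) xs↭ys)
                            (trans (∑⊆-↭ _ (f-inv ∘ ↭.prep x ∘ ↭.prep y) xs↭ys)
                                   (∑-cong (sublists ys) (λ _ → f-inv (↭.swap x y ↭.refl))))) ⟩
  (∑⊆ ys f + ∑[ s ⊆ ys ] f (x ∷ s)) + (∑[ s ⊆ ys ] f (y ∷ s) + ∑[ s ⊆ ys ] f (y ∷ x ∷ s))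
    ≡⟨ trans (∑⊆-∷ y (x ∷ ys) f) (cong₂ _+_ (∑⊆-∷ x ys f) (∑⊆-∷ x ys _)) ⟨
  ∑⊆ (y ∷ x ∷ ys) f
    ∎
  where open ≡-Reasoning
∑⊆-↭ f f-inv (↭.trans xs↭ys ys↭zs) = trans (∑⊆-↭ f f-inv xs↭ys) (∑⊆-↭ f f-inv ys↭zs)

applyUpTo-+ : ∀ (f : ℕ → A) p k → applyUpTo f (p + k) ≡ applyUpTo f p ++ applyUpTo (f ∘ (p +_)) k
applyUpTo-+ f zero    k = refl
applyUpTo-+ f (suc p) k = cong (f 0 ∷_) (applyUpTo-+ (f ∘ suc) p k)

map-upTo-+ : ∀ (f : ℕ → A) p k → map f (upTo (p + k)) ≡ map f (upTo p) ++ map (f ∘ (p +_)) (upTo k)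
map-upTo-+ f p k = begin
  map f (upTo (p + k))                               ≡⟨ map-upTo f (p + k) ⟩
  applyUpTo f (p + k)                                ≡⟨ applyUpTo-+ f p k ⟩
  applyUpTo f p ++ applyUpTo (f ∘ (p +_)) k          ≡⟨ cong₂ _++_ (map-upTo f p) (map-upTo (f ∘ (p +_)) k) ⟨
  map f (upTo p) ++ map (f ∘ (p +_)) (upTo k)        ∎
  where open ≡-Reasoning

concatMap-upTo-+ : ∀ (f : ℕ → List A) p k → concatMap f (upTo (p + k)) ≡ concatMap f (upTo p) ++ concatMap (f ∘ (p +_)) (upTo k)
concatMap-upTo-+ f p k = trans (cong concat (map-upTo-+ f p k)) (sym (concat-++ (map f (upTo p)) _))

map-upTo-+-suc : ∀ (f : ℕ → A) p k → map f (upTo (p + suc k)) ≡ map f (upTo p) ++ f p ∷ map (f ∘ (suc p +_)) (upTo k)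
map-upTo-+-suc f p k = begin
  map f (upTo (p + suc k))                                     ≡⟨ cong (map f ∘ upTo) (+-suc p k) ⟩
  map f (upTo (suc p + k))                                     ≡⟨ map-upTo-+ f (suc p) k ⟩
  map f (upTo (suc p)) ++ map (f ∘ (suc p +_)) (upTo k)        ≡⟨ cong (λ xs → map f xs ++ rest) (upTo-∷ʳ p) ⟨
  map f (upTo p ∷ʳ p) ++ map (f ∘ (suc p +_)) (upTo k)         ≡⟨ cong (_++ rest) (map-++ f (upTo p) [ p ]) ⟩
  (map f (upTo p) ++ [ f p ]) ++ map (f ∘ (suc p +_)) (upTo k) ≡⟨ ++-assoc (map f (upTo p)) _ _ ⟩
  map f (upTo p) ++ f p ∷ map (f ∘ (suc p +_)) (upTo k)        ∎
  where
  open ≡-Reasoning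
  rest = map (f ∘ (suc p +_)) (upTo k)

upTo-suc : ∀ n → upTo (suc n) ≡ 0 ∷ map suc (upTo n)
upTo-suc n = cong (0 ∷_) (sym (map-upTo suc n))

All-map-upTo : ∀ {P : A → Set} (f : ℕ → A) n → (∀ {i} → i < n → P (f i)) → All P (map f (upTo n))
All-map-upTo {P = P} f n Pf = subst (All P) (sym (map-upTo f n)) (applyUpTo⁺₁ f n Pf)

↭-interchange : ∀ (as bs cs ds : List A) → (as ++ bs) ++ (cs ++ ds) ↭ (as ++ cs) ++ (bs ++ ds)
↭-interchange as bs cs ds = begin
  (as ++ bs) ++ (cs ++ ds)  ≡⟨ ++-assoc as bs _ ⟩
  as ++ bs ++ cs ++ ds      ↭⟨ ++⁺ˡ as (shifts bs cs) ⟩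
  as ++ cs ++ bs ++ ds      ≡⟨ ++-assoc as cs _ ⟨
  (as ++ cs) ++ (bs ++ ds)  ∎
  where open PermutationReasoning

↭-gather : ∀ (h₁ h₂ v₁ v₂ i₁ i₂ d₁ d₂ : List A) x y →
           (h₁ ++ x ∷ h₂) ++ (v₁ ++ v₂) ++ (i₁ ++ i₂) ++ (d₁ ++ y ∷ d₂) ↭ (h₁ ++ v₁ ++ i₁ ++ d₁) ++ x ∷ y ∷ h₂ ++ v₂ ++ i₂ ++ d₂
↭-gather h₁ h₂ v₁ v₂ i₁ i₂ d₁ d₂ x y = begin
  (h₁ ++ x ∷ h₂) ++ (v₁ ++ v₂) ++ (i₁ ++ i₂) ++ (d₁ ++ y ∷ d₂)   ↭⟨ ++⁺ˡ (h₁ ++ x ∷ h₂) (++⁺ˡ (v₁ ++ v₂) (↭-interchange i₁ i₂ d₁ _)) ⟩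
  (h₁ ++ x ∷ h₂) ++ (v₁ ++ v₂) ++ (i₁ ++ d₁) ++ (i₂ ++ y ∷ d₂)   ↭⟨ ++⁺ˡ (h₁ ++ x ∷ h₂) (↭-interchange v₁ v₂ (i₁ ++ d₁) _) ⟩
  (h₁ ++ x ∷ h₂) ++ (v₁ ++ i₁ ++ d₁) ++ (v₂ ++ i₂ ++ y ∷ d₂)     ↭⟨ ↭-interchange h₁ (x ∷ h₂) (v₁ ++ i₁ ++ d₁) _ ⟩
  (h₁ ++ v₁ ++ i₁ ++ d₁) ++ x ∷ h₂ ++ v₂ ++ i₂ ++ y ∷ d₂         ↭⟨ ++⁺ˡ (h₁ ++ v₁ ++ i₁ ++ d₁) (↭.prep x y-to-front) ⟩
  (h₁ ++ v₁ ++ i₁ ++ d₁) ++ x ∷ y ∷ h₂ ++ v₂ ++ i₂ ++ d₂         ∎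
  where
  open PermutationReasoning
  y-to-front : h₂ ++ v₂ ++ i₂ ++ y ∷ d₂ ↭ y ∷ h₂ ++ v₂ ++ i₂ ++ d₂
  y-to-front = ↭.trans (++⁺ˡ h₂ (++⁺ˡ v₂ (shift y i₂ d₂))) (↭.trans (++⁺ˡ h₂ (shift y v₂ _)) (shift y h₂ _))

-- noneUpTo (breakable M) j is unbreakable (suc j) M by definition.
noneUpTo : (ℕ → Bool) → ℕ → Bool
noneUpTo br j = all (λ i → not (br (suc i))) (upTo j)

firstAt : (ℕ → Bool) → ℕ → Bool
firstAt br j = noneUpTo br j ∧ br (suc j)

noneUpTo-suc : ∀ br j → noneUpTo br (suc j) ≡ not (br 1) ∧ noneUpTo (br ∘ suc) j
noneUpTo-suc br j = trans (cong (all (λ i → not (br (suc i)))) (upTo-suc j)) (cong (not (br 1) ∧_) (all-map _ suc (upTo j)))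

none-or-first : ∀ br n → toℕ (noneUpTo br n) + ∑[ j ∈ upTo n ] toℕ (firstAt br j) ≡ 1
none-or-first br zero    = refl
none-or-first br (suc n) = begin
  toℕ (noneUpTo br (suc n)) + ∑[ j ∈ upTo (suc n) ] toℕ (firstAt br j)
    ≡⟨ cong₂ _+_ (cong toℕ (noneUpTo-suc br n)) (cong (λ js → ∑ js (toℕ ∘ firstAt br)) (upTo-suc n)) ⟩
  toℕ (not (br 1) ∧ noneUpTo br′ n) + (toℕ (br 1) + ∑ (map suc (upTo n)) (toℕ ∘ firstAt br))
    ≡⟨ cong (λ s → toℕ (not (br 1) ∧ noneUpTo br′ n) + (toℕ (br 1) + s)) later-firsts ⟩
  toℕ (not (br 1) ∧ noneUpTo br′ n) + (toℕ (br 1) + ∑[ j ∈ upTo n ] toℕ (not (br 1) ∧ firstAt br′ j))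
    ≡⟨ by-first (br 1) ⟩
  1 ∎
  where
  open ≡-Reasoning
  br′ = br ∘ suc
  later-firsts : ∑ (map suc (upTo n)) (toℕ ∘ firstAt br) ≡ ∑[ j ∈ upTo n ] toℕ (not (br 1) ∧ firstAt br′ j)
  later-firsts = trans (∑-map suc (upTo n) (toℕ ∘ firstAt br)) (∑-cong (upTo n) λ j →
    cong toℕ (trans (cong (_∧ br (2 + j)) (noneUpTo-suc br j)) (∧-assoc (not (br 1)) _ _)))
  by-first : ∀ b → toℕ (not b ∧ noneUpTo br′ n) + (toℕ b + ∑[ j ∈ upTo n ] toℕ (not b ∧ firstAt br′ j)) ≡ 1
  by-first true  = cong suc (∑-zero (universal (λ _ → refl) (upTo n)))
  by-first false = none-or-first br′ n

-- Splitting a board into two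

shiftSq : ℕ → Sq → Sq
shiftSq p (S j)   = S (p + j)
shiftSq p (L j t) = L (p + j) t

shiftEdge : ℕ → Edge → Edge
shiftEdge p (u , v) = shiftSq p u , shiftSq p v

col-shiftSq : ∀ p u → col (shiftSq p u) ≡ p + col u
col-shiftSq p (S j)   = refl
col-shiftSq p (L j t) = refl

squares-+ : ∀ q p k → squares q (p + k) ↭ squares q p ++ map (shiftSq p) (squares q k)
squares-+ q p k = begin
  squares q (p + k)
    ≡⟨ cong₂ _++_ (map-upTo-+ S p k) (concatMap-upTo-+ column p k) ⟩
  (map S (upTo p) ++ firsts) ++ (concatMap column (upTo p) ++ seconds)
    ↭⟨ ↭-interchange (map S (upTo p)) firsts _ seconds ⟩
  squares q p ++ (firsts ++ seconds)
    ≡⟨ cong (squares q p ++_) shifted ⟨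
  squares q p ++ map (shiftSq p) (squares q k)
    ∎
  where
  open PermutationReasoning
  column : ℕ → List Sq
  column j = map (L j) (upTo (q ∸ 3))
  firsts = map (S ∘ (p +_)) (upTo k)
  seconds = concatMap (column ∘ (p +_)) (upTo k)
  shifted : map (shiftSq p) (squares q k) ≡ firsts ++ seconds
  shifted = trans (map-++ (shiftSq p) (map S (upTo k)) _) (cong₂ _++_ (sym (map-∘ (upTo k)))
              (trans (map-concatMap (shiftSq p) column (upTo k)) (concatMap-cong (λ _ → sym (map-∘ (upTo (q ∸ 3)))) (upTo k))))

-- The only two dominoes of the board joining column j to column j + 1.
bridge₁ : ℕ → Edge
bridge₁ j = S j , S (suc j)

bridge₂ : ℕ → ℕ → Edge
bridge₂ q j = L j (q ∸ 3 ∸ 1) , L (suc j) 0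

edges-+ : ∀ q p′ k′ → edges q (suc p′ + suc k′) ↭
          edges q (suc p′) ++ bridge₁ p′ ∷ bridge₂ q p′ ∷ map (shiftEdge (suc p′)) (edges q (suc k′))
edges-+ q p′ k′ = begin
  edges q (p + k)
    ≡⟨ cong₂ _++_ (map-upTo-+-suc bridge₁ p′ k′)
         (cong₂ _++_ (map-upTo-+ vertical p k) (cong₂ _++_ (concatMap-upTo-+ inner p k) (map-upTo-+-suc (bridge₂ q) p′ k′))) ⟩
  (H₁ ++ bridge₁ p′ ∷ H₂′) ++ (V₁ ++ V₂) ++ (I₁ ++ I₂) ++ (D₁ ++ bridge₂ q p′ ∷ D₂′)
    ≡⟨ cong₂ (λ H₂ D₂ → (H₁ ++ bridge₁ p′ ∷ H₂) ++ (V₁ ++ V₂) ++ (I₁ ++ I₂) ++ (D₁ ++ bridge₂ q p′ ∷ D₂))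
             (shifted-bridges bridge₁ (λ i → cong (λ z → S (p + i) , S z) (sym (+-suc p i))))
             (shifted-bridges (bridge₂ q) (λ i → cong (λ z → L (p + i) (q ∸ 3 ∸ 1) , L z 0) (sym (+-suc p i)))) ⟩
  (H₁ ++ bridge₁ p′ ∷ H₂) ++ (V₁ ++ V₂) ++ (I₁ ++ I₂) ++ (D₁ ++ bridge₂ q p′ ∷ D₂)
    ↭⟨ ↭-gather H₁ H₂ V₁ V₂ I₁ I₂ D₁ D₂ (bridge₁ p′) (bridge₂ q p′) ⟩
  edges q p ++ bridge₁ p′ ∷ bridge₂ q p′ ∷ H₂ ++ V₂ ++ I₂ ++ D₂
    ≡⟨ cong (λ T → edges q p ++ bridge₁ p′ ∷ bridge₂ q p′ ∷ T) shifted ⟨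
  edges q p ++ bridge₁ p′ ∷ bridge₂ q p′ ∷ map (shiftEdge p) (edges q k)
    ∎
  where
  open PermutationReasoning
  p = suc p′
  k = suc k′
  vertical : ℕ → Edge
  vertical j = S j , L j 0
  inner : ℕ → List Edge
  inner j = map (λ t → L j t , L j (suc t)) (upTo (q ∸ 3 ∸ 1))
  H₁ = map bridge₁ (upTo p′)
  H₂′ = map (bridge₁ ∘ (p +_)) (upTo k′)
  H₂ = map (shiftEdge p) (map bridge₁ (upTo k′))
  V₁ = map vertical (upTo p)
  V₂ = map (vertical ∘ (p +_)) (upTo k)
  I₁ = concatMap inner (upTo p)
  I₂ = concatMap (inner ∘ (p +_)) (upTo k)
  D₁ = map (bridge₂ q) (upTo p′)
  D₂′ = map (bridge₂ q ∘ (p +_)) (upTo k′)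
  D₂ = map (shiftEdge p) (map (bridge₂ q) (upTo k′))
  shifted-bridges : ∀ (f : ℕ → Edge) → (∀ i → f (p + i) ≡ shiftEdge p (f i)) →
                    map (f ∘ (p +_)) (upTo k′) ≡ map (shiftEdge p) (map f (upTo k′))
  shifted-bridges f f-shift = trans (map-cong f-shift (upTo k′)) (map-∘ (upTo k′))
  shifted : map (shiftEdge p) (edges q k) ≡ H₂ ++ V₂ ++ I₂ ++ D₂
  shifted = trans (map-++ (shiftEdge p) (map bridge₁ (upTo k′)) _)
    (cong (H₂ ++_) (trans (map-++ (shiftEdge p) (map vertical (upTo k)) _) (cong₂ _++_ (sym (map-∘ (upTo k)))
      (trans (map-++ (shiftEdge p) (concatMap inner (upTo k)) _) (cong (_++ D₂)
        (trans (map-concatMap (shiftEdge p) inner (upTo k)) (concatMap-cong (λ _ → sym (map-∘ (upTo (q ∸ 3 ∸ 1)))) (upTo k))))))))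

==-refl : ∀ u → (u == u) ≡ true
==-refl (S j)   = ≡ᵇ-refl j
==-refl (L j t) = cong₂ _∧_ (≡ᵇ-refl j) (≡ᵇ-refl t)

==-col≢ : ∀ u v → col u ≢ col v → (u == v) ≡ false
==-col≢ (S i)   (S j)   i≢j = ≢⇒≡ᵇ≡false i≢j
==-col≢ (S i)   (L j t) _   = refl
==-col≢ (L i s) (S j)   _   = refl
==-col≢ (L i s) (L j t) i≢j = cong (_∧ (s ≡ᵇ t)) (≢⇒≡ᵇ≡false i≢j)

==-shiftSq : ∀ p u v → (shiftSq p u == shiftSq p v) ≡ (u == v)
==-shiftSq p (S i)   (S j)   = ≡ᵇ-+ˡ p i j
==-shiftSq p (S i)   (L j t) = refl
==-shiftSq p (L i s) (S j)   = refl
==-shiftSq p (L i s) (L j t) = cong (_∧ (s ≡ᵇ t)) (≡ᵇ-+ˡ p i j)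

shiftSq-col≢ : ∀ {p} s u → col s < p → col s ≢ col (shiftSq p u)
shiftSq-col≢ {p} s u cs<p = <⇒≢ (<-≤-trans cs<p (≤-trans (m≤m+n p (col u)) (≤-reflexive (sym (col-shiftSq p u)))))

incident-shift : ∀ p s e → incident (shiftSq p s) (shiftEdge p e) ≡ incident s e
incident-shift p s (u , v) = cong₂ _∨_ (==-shiftSq p s u) (==-shiftSq p s v)

WithinColumns : ℕ → Edge → Set
WithinColumns n (u , v) = col u < n × col v < n

JoinsTwoSquares : List Sq → Edge → Set
JoinsTwoSquares V e = 2 ≤ count (λ s → incident s e) V

OnBoard : ℕ → ℕ → Edge → Set
OnBoard q n e = WithinColumns n e × JoinsTwoSquares (squares q n) e

squares-col : ∀ q n → All (λ s → col s < n) (squares q n)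
squares-col q n = ++⁺ (All-map-upTo S n id) (concat⁺ (All-map-upTo _ n (λ j<n → All-map-upTo (L _) (q ∸ 3) (λ _ → j<n))))

S∈squares : ∀ q {n j} → j < n → S j ∈ squares q n
S∈squares q j<n = ∈-++⁺ˡ (∈-map⁺ S (∈-upTo⁺ j<n))

L∈squares : ∀ q {n j t} → j < n → t < q ∸ 3 → L j t ∈ squares q n
L∈squares q {n} {j} j<n t<m =
  ∈-++⁺ʳ (map S (upTo n)) (∈-concat⁺′ (∈-map⁺ (L j) (∈-upTo⁺ t<m)) (∈-map⁺ (λ j → map (L j) (upTo (q ∸ 3))) (∈-upTo⁺ j<n)))

joinsTwoSquares : ∀ {V u v} → u ∈ V → v ∈ V → u ≢ v → JoinsTwoSquares V (u , v)
joinsTwoSquares {V} {u} {v} u∈V v∈V u≢v = count-≥2 (λ s → incident s (u , v)) u∈V v∈V u≢v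
  (cong (_∨ (u == v)) (==-refl u)) (trans (cong ((v == u) ∨_) (==-refl v)) (∨-zeroʳ (v == u)))

edges-onBoard : ∀ q n → 1 ≤ q ∸ 3 → All (OnBoard q n) (edges q n)
edges-onBoard q n 1≤m = ++⁺ horizontal (++⁺ vertical (++⁺ inner diagonal))
  where
  m = q ∸ 3
  suc<⇒< : ∀ {i n} → suc i < n → i < n
  suc<⇒< = <⇒≤
  <∸1⇒suc< : ∀ {i n} → i < n ∸ 1 → suc i < n
  <∸1⇒suc< {n = suc n} i<n = s≤s i<n
  ∸1< : ∀ {n} → 1 ≤ n → n ∸ 1 < n
  ∸1< {suc n} _ = ≤-refl
  horizontal : All (OnBoard q n) (map bridge₁ (upTo (n ∸ 1)))
  horizontal = All-map-upTo bridge₁ (n ∸ 1) λ i<n∸1 → let i+1<n = <∸1⇒suc< i<n∸1 in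
    (suc<⇒< i+1<n , i+1<n) , joinsTwoSquares (S∈squares q (suc<⇒< i+1<n)) (S∈squares q i+1<n) (λ ())
  vertical : All (OnBoard q n) (map (λ j → S j , L j 0) (upTo n))
  vertical = All-map-upTo _ n λ j<n → (j<n , j<n) , joinsTwoSquares (S∈squares q j<n) (L∈squares q j<n 1≤m) (λ ())
  inner : All (OnBoard q n) (concatMap (λ j → map (λ t → L j t , L j (suc t)) (upTo (m ∸ 1))) (upTo n))
  inner = concat⁺ (All-map-upTo _ n λ j<n → All-map-upTo _ (m ∸ 1) λ t<m∸1 → let t+1<m = <∸1⇒suc< t<m∸1 in
    (j<n , j<n) , joinsTwoSquares (L∈squares q j<n (suc<⇒< t+1<m)) (L∈squares q j<n t+1<m) (λ ()))
  diagonal : All (OnBoard q n) (map (bridge₂ q) (upTo (n ∸ 1)))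
  diagonal = All-map-upTo (bridge₂ q) (n ∸ 1) λ j<n∸1 → let j+1<n = <∸1⇒suc< j<n∸1 in
    (suc<⇒< j+1<n , j+1<n) , joinsTwoSquares (L∈squares q (suc<⇒< j+1<n) (∸1< 1≤m)) (L∈squares q j+1<n 1≤m) (λ ())

tiling-size : ∀ V M → All (JoinsTwoSquares V) M → all (λ s → count (incident s) M <ᵇ 2) V ≡ true → 2 * length M ≤ length V
tiling-size V M joins disjoint = begin
  2 * length M                                ≤⟨ *-length≤∑ 2 joins ⟩
  ∑[ e ∈ M ] count (λ s → incident s e) V     ≡⟨ ∑-count-comm incident V M ⟩
  ∑[ s ∈ V ] count (incident s) M             ≤⟨ ∑≤length (λ s → count (incident s) M) V disjoint ⟩
  length V                                    ∎
  where open ≤-Reasoning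

within⇒¬crosses : ∀ {i} e → WithinColumns i e → crosses i e ≡ false
within⇒¬crosses (u , v) (u<i , v<i) = cong₂ _xor_ (<⇒<ᵇ≡true u<i) (<⇒<ᵇ≡true v<i)

shiftEdge-¬crosses : ∀ {i p} e → i ≤ p → crosses i (shiftEdge p e) ≡ false
shiftEdge-¬crosses {i} {p} (u , v) i≤p = cong₂ _xor_ (≤⇒<ᵇ≡false (beyond u)) (≤⇒<ᵇ≡false (beyond v))
  where
  beyond : ∀ w → i ≤ col (shiftSq p w)
  beyond w = ≤-trans i≤p (≤-trans (m≤m+n p (col w)) (≤-reflexive (sym (col-shiftSq p w))))

bridge₁-crosses : ∀ j → crosses (suc j) (bridge₁ j) ≡ true
bridge₁-crosses j = cong₂ _xor_ (<⇒<ᵇ≡true (n<1+n j)) (≤⇒<ᵇ≡false (≤-refl {suc j}))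

bridge₂-crosses : ∀ q j → crosses (suc j) (bridge₂ q j) ≡ true
bridge₂-crosses q = bridge₁-crosses

-- Tilings and their weights

isTiling-↭ : ∀ q n {M M′} → M ↭ M′ → isTiling q n M ≡ isTiling q n M′
isTiling-↭ q n M↭M′ = all-cong (squares q n) (λ s → cong (_<ᵇ 2) (count-↭ (incident s) M↭M′))

breakable-↭ : ∀ {M M′} → M ↭ M′ → ∀ i → breakable M i ≡ breakable M′ i
breakable-↭ M↭M′ i = cong not (any-↭ (crosses i) M↭M′)

unbreakable-↭ : ∀ n {M M′} → M ↭ M′ → unbreakable n M ≡ unbreakable n M′
unbreakable-↭ n M↭M′ = all-cong (upTo (n ∸ 1)) (λ i → cong not (breakable-↭ M↭M′ (suc i)))

colourings-↭ : ∀ q a b n {M M′} → M ↭ M′ → colourings q a b n M ≡ colourings q a b n M′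
colourings-↭ q a b n M↭M′ = cong (λ E → a ^ (length (squares q n) ∸ 2 * E) * b ^ E) (↭-length M↭M′)

module Concatenation (q j k : ℕ) {s₁ s₃ : List Edge} (s₁-on : All (OnBoard q (suc j)) s₁) (s₃-on : All (OnBoard q k) s₃) where

  p = suc j
  M = s₁ ++ map (shiftEdge p) s₃

  count-left : ∀ s → col s < p → count (incident s) M ≡ count (incident s) s₁
  count-left s cs<p = begin
    count (incident s) M                                        ≡⟨ count-++ (incident s) s₁ _ ⟩
    count (incident s) s₁ + count (incident s) (map (shiftEdge p) s₃)
      ≡⟨ cong (count (incident s) s₁ +_) (trans (count-map (incident s) (shiftEdge p) s₃) (count-none (universal misses s₃))) ⟩
    count (incident s) s₁ + 0                                   ≡⟨ +-identityʳ _ ⟩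
    count (incident s) s₁                                       ∎
    where
    open ≡-Reasoning
    misses : ∀ e → incident s (shiftEdge p e) ≡ false
    misses (u , v) = cong₂ _∨_ (==-col≢ s _ (shiftSq-col≢ s u cs<p)) (==-col≢ s _ (shiftSq-col≢ s v cs<p))

  count-right : ∀ s → count (incident (shiftSq p s)) M ≡ count (incident s) s₃
  count-right s = begin
    count (incident (shiftSq p s)) M
      ≡⟨ count-++ (incident (shiftSq p s)) s₁ _ ⟩
    count (incident (shiftSq p s)) s₁ + count (incident (shiftSq p s)) (map (shiftEdge p) s₃)
      ≡⟨ cong₂ _+_ (count-none (All.map misses s₁-on)) (trans (count-map _ (shiftEdge p) s₃) (count-cong s₃ (incident-shift p s))) ⟩
    count (incident s) s₃
      ∎
    where
    open ≡-Reasoning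
    misses : ∀ {e} → OnBoard q p e → incident (shiftSq p s) e ≡ false
    misses {u , v} ((u<p , v<p) , _) =
      cong₂ _∨_ (==-col≢ (shiftSq p s) u (shiftSq-col≢ u s u<p ∘ sym)) (==-col≢ (shiftSq p s) v (shiftSq-col≢ v s v<p ∘ sym))

  isTiling-++ : isTiling q (p + k) M ≡ isTiling q p s₁ ∧ isTiling q k s₃
  isTiling-++ = begin
    all disjointAt (squares q (p + k))                                   ≡⟨ all-↭ disjointAt (squares-+ q p k) ⟩
    all disjointAt (squares q p ++ map (shiftSq p) (squares q k))       ≡⟨ all-++ disjointAt (squares q p) _ ⟩
    all disjointAt (squares q p) ∧ all disjointAt (map (shiftSq p) (squares q k))
      ≡⟨ cong₂ _∧_ (all-congᴬ (squares-col q p) (λ {s} cs<p → cong (_<ᵇ 2) (count-left s cs<p)))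
                   (trans (all-map disjointAt (shiftSq p) (squares q k))
                          (all-cong (squares q k) (λ s → cong (_<ᵇ 2) (count-right s)))) ⟩
    isTiling q p s₁ ∧ isTiling q k s₃                                    ∎
    where
    open ≡-Reasoning
    disjointAt : Sq → Bool
    disjointAt s = count (incident s) M <ᵇ 2

  breakable-++ : ∀ {i} → i ≤ p → breakable M i ≡ breakable s₁ i
  breakable-++ {i} i≤p = cong not (begin
    any (crosses i) M                                                 ≡⟨ any-++ (crosses i) s₁ _ ⟩
    any (crosses i) s₁ ∨ any (crosses i) (map (shiftEdge p) s₃)       ≡⟨ cong (any (crosses i) s₁ ∨_) shifted-uncrossed ⟩
    any (crosses i) s₁ ∨ false                                        ≡⟨ ∨-identityʳ _ ⟩
    any (crosses i) s₁                                                ∎)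
    where
    open ≡-Reasoning
    shifted-uncrossed : any (crosses i) (map (shiftEdge p) s₃) ≡ false
    shifted-uncrossed = trans (any-map (crosses i) (shiftEdge p) s₃) (any-false (universal (λ e → shiftEdge-¬crosses e i≤p) s₃))

  unbreakable-++ : unbreakable p M ≡ unbreakable p s₁
  unbreakable-++ = all-congᴬ (applyUpTo⁺₁ id j id) (λ i<j → cong not (breakable-++ (≤-trans i<j (n≤1+n j))))

  breakable-++-at-p : breakable M p ≡ true
  breakable-++-at-p = trans (breakable-++ ≤-refl) (cong not (any-false (All.map (λ {e} → within⇒¬crosses e ∘ proj₁) s₁-on)))

  -- The size bounds make the truncated subtractions in the exponents of colourings split additively.
  colourings-++ : ∀ a b → isTiling q p s₁ ≡ true → isTiling q k s₃ ≡ true →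
                  colourings q a b (p + k) M ≡ colourings q a b p s₁ * colourings q a b k s₃
  colourings-++ a b s₁-tiles s₃-tiles = begin
    a ^ (length (squares q (p + k)) ∸ 2 * length M) * b ^ length M
      ≡⟨ cong₂ (λ V E → a ^ (V ∸ 2 * E) * b ^ E) squares-length (length-++ s₁) ⟩
    a ^ ((Vp + Vk) ∸ 2 * (Ep + length (map (shiftEdge p) s₃))) * b ^ (Ep + length (map (shiftEdge p) s₃))
      ≡⟨ cong (λ Ek → a ^ ((Vp + Vk) ∸ 2 * (Ep + Ek)) * b ^ (Ep + Ek)) (length-map (shiftEdge p) s₃) ⟩
    a ^ ((Vp + Vk) ∸ 2 * (Ep + Ek)) * b ^ (Ep + Ek)
      ≡⟨ cong (λ z → a ^ ((Vp + Vk) ∸ z) * b ^ (Ep + Ek)) (*-distribˡ-+ 2 Ep Ek) ⟩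
    a ^ ((Vp + Vk) ∸ (2 * Ep + 2 * Ek)) * b ^ (Ep + Ek)
      ≡⟨ cong (λ z → a ^ z * b ^ (Ep + Ek)) ([m+n]∸[o+r]≡[m∸o]+[n∸r] Vp Vk (size s₁-on s₁-tiles) (size s₃-on s₃-tiles)) ⟩
    a ^ ((Vp ∸ 2 * Ep) + (Vk ∸ 2 * Ek)) * b ^ (Ep + Ek)
      ≡⟨ cong₂ _*_ (^-distribˡ-+-* a (Vp ∸ 2 * Ep) (Vk ∸ 2 * Ek)) (^-distribˡ-+-* b Ep Ek) ⟩
    (a ^ (Vp ∸ 2 * Ep) * a ^ (Vk ∸ 2 * Ek)) * (b ^ Ep * b ^ Ek)
      ≡⟨ *-CS.interchange (a ^ (Vp ∸ 2 * Ep)) _ _ _ ⟩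
    (a ^ (Vp ∸ 2 * Ep) * b ^ Ep) * (a ^ (Vk ∸ 2 * Ek) * b ^ Ek)
      ∎
    where
    open ≡-Reasoning
    Vp = length (squares q p)
    Vk = length (squares q k)
    Ep = length s₁
    Ek = length s₃
    squares-length : length (squares q (p + k)) ≡ Vp + Vk
    squares-length = trans (↭-length (squares-+ q p k))
                           (trans (length-++ (squares q p)) (cong (Vp +_) (length-map (shiftSq p) (squares q k))))
    size : ∀ {n s} → All (OnBoard q n) s → isTiling q n s ≡ true → 2 * length s ≤ length (squares q n)
    size {n} {s} on tiles = tiling-size (squares q n) s (All.map proj₂ on) tiles

module Weights (q a b : ℕ) (1≤q∸3 : 1 ≤ q ∸ 3) where

  weight : ℕ → List Edge → ℕ
  weight n M = toℕ (isTiling q n M) * colourings q a b n M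

  unbreakableWeight : ℕ → List Edge → ℕ
  unbreakableWeight n M = toℕ (unbreakable n M) * weight n M

  firstBreakWeight : ℕ → ℕ → List Edge → ℕ
  firstBreakWeight n j M = toℕ (firstAt (breakable M) j) * weight n M

  R≡∑⊆ : ∀ n → R q a b n ≡ ∑⊆ (edges q n) (weight n)
  R≡∑⊆ n = ∑-filterᵇ (isTiling q n) (sublists (edges q n)) (colourings q a b n)

  R̃≡∑⊆ : ∀ n → R̃ q a b n ≡ ∑⊆ (edges q n) (unbreakableWeight n)
  R̃≡∑⊆ n = begin
    R̃ q a b n
      ≡⟨ ∑-filterᵇ (unbreakable n) (tilings q n) (colourings q a b n) ⟩
    ∑[ M ∈ tilings q n ] (toℕ (unbreakable n M) * colourings q a b n M)
      ≡⟨ ∑-filterᵇ (isTiling q n) (sublists (edges q n)) _ ⟩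
    ∑[ M ⊆ edges q n ] (toℕ (isTiling q n M) * (toℕ (unbreakable n M) * colourings q a b n M))
      ≡⟨ ∑-cong (sublists (edges q n)) (λ M → *-CS.x∙yz≈y∙xz (toℕ (isTiling q n M)) (toℕ (unbreakable n M)) (colourings q a b n M)) ⟩
    ∑⊆ (edges q n) (unbreakableWeight n)
      ∎
    where open ≡-Reasoning

  firstBreakWeight-↭ : ∀ n j {M M′} → M ↭ M′ → firstBreakWeight n j M ≡ firstBreakWeight n j M′
  firstBreakWeight-↭ n j M↭M′ =
    cong₂ _*_ (cong toℕ (cong₂ _∧_ (unbreakable-↭ (suc j) M↭M′) (breakable-↭ M↭M′ (suc j))))
              (cong₂ _*_ (cong toℕ (isTiling-↭ q n M↭M′)) (colourings-↭ q a b n M↭M′))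

  firstBreakWeight-bridged : ∀ n j s₁ c t → crosses (suc j) c ≡ true → firstBreakWeight n j (s₁ ++ c ∷ t) ≡ 0
  firstBreakWeight-bridged n j s₁ c t c-crosses = cong (λ b → toℕ b * weight n M) (begin
    unbreakable (suc j) M ∧ not (any (crosses (suc j)) M)
      ≡⟨ cong (λ b → unbreakable (suc j) M ∧ not b) (any-crossed (crosses (suc j)) s₁ c t c-crosses) ⟩
    unbreakable (suc j) M ∧ false
      ≡⟨ ∧-zeroʳ _ ⟩
    false
      ∎)
    where
    open ≡-Reasoning
    M = s₁ ++ c ∷ t

  concatenation-weight : ∀ j k {s₁ s₃} → All (OnBoard q (suc j)) s₁ → All (OnBoard q k) s₃ →
    firstBreakWeight (suc j + k) j (s₁ ++ map (shiftEdge (suc j)) s₃) ≡ unbreakableWeight (suc j) s₁ * weight k s₃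
  concatenation-weight j k {s₁} {s₃} s₁-on s₃-on = begin
    toℕ (unbreakable p M ∧ breakable M p) * (toℕ (isTiling q (p + k) M) * colourings q a b (p + k) M)
      ≡⟨ cong₂ (λ u t → toℕ u * (toℕ t * colourings q a b (p + k) M))
               (cong₂ _∧_ unbreakable-++ breakable-++-at-p) isTiling-++ ⟩
    toℕ (u ∧ true) * (toℕ (t₁ ∧ t₃) * colourings q a b (p + k) M)
      ≡⟨ cong (toℕ (u ∧ true) *_) (toℕ-∧-*-cong t₁ t₃ (colourings-++ a b)) ⟩
    toℕ (u ∧ true) * (toℕ (t₁ ∧ t₃) * (c₁ * c₃))
      ≡⟨ cong₂ (λ x y → toℕ x * (y * (c₁ * c₃))) (∧-identityʳ u) (toℕ-∧ t₁ t₃) ⟩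
    toℕ u * ((toℕ t₁ * toℕ t₃) * (c₁ * c₃))
      ≡⟨ regroup (toℕ u) (toℕ t₁) (toℕ t₃) c₁ c₃ ⟩
    (toℕ u * (toℕ t₁ * c₁)) * (toℕ t₃ * c₃)
      ∎
    where
    open ≡-Reasoning
    open Concatenation q j k s₁-on s₃-on
    u = unbreakable p s₁
    t₁ = isTiling q p s₁
    t₃ = isTiling q k s₃
    c₁ = colourings q a b p s₁
    c₃ = colourings q a b k s₃
    regroup : ∀ u x y c d → u * ((x * y) * (c * d)) ≡ (u * (x * c)) * (y * d)
    regroup = solve-∀

  first-break-at : ∀ j k′ → ∑⊆ (edges q (suc j + suc k′)) (firstBreakWeight (suc j + suc k′) j) ≡ R̃ q a b (suc j) * R q a b (suc k′)
  first-break-at j k′ = begin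
    ∑⊆ (edges q (p + k)) w
      ≡⟨ ∑⊆-↭ w (firstBreakWeight-↭ (p + k) j) (edges-+ q j k′) ⟩
    ∑⊆ (edges q p ++ bridge₁ j ∷ bridge₂ q j ∷ shifted) w
      ≡⟨ ∑⊆-++ (edges q p) _ w ⟩
    ∑[ s₁ ⊆ edges q p ] ∑[ t ⊆ bridge₁ j ∷ bridge₂ q j ∷ shifted ] w (s₁ ++ t)
      ≡⟨ ∑-cong (sublists (edges q p)) unbridged ⟩
    ∑[ s₁ ⊆ edges q p ] ∑[ t ⊆ shifted ] w (s₁ ++ t)
      ≡⟨ ∑-cong (sublists (edges q p)) (λ s₁ → ∑⊆-map (shiftEdge p) (edges q k) (λ t → w (s₁ ++ t))) ⟩
    ∑[ s₁ ⊆ edges q p ] ∑[ s₃ ⊆ edges q k ] w (s₁ ++ map (shiftEdge p) s₃)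
      ≡⟨ ∑⊆-congᴬ (edges-onBoard q p 1≤q∸3) (λ s₁-on → ∑⊆-congᴬ (edges-onBoard q k 1≤q∸3) (concatenation-weight j k s₁-on)) ⟩
    ∑[ s₁ ⊆ edges q p ] ∑[ s₃ ⊆ edges q k ] (unbreakableWeight p s₁ * weight k s₃)
      ≡⟨ ∑-cong (sublists (edges q p)) (λ s₁ → ∑-*ˡ (sublists (edges q k)) (unbreakableWeight p s₁) (weight k)) ⟩
    ∑[ s₁ ⊆ edges q p ] (unbreakableWeight p s₁ * ∑⊆ (edges q k) (weight k))
      ≡⟨ ∑-*ʳ (sublists (edges q p)) _ (unbreakableWeight p) ⟩
    ∑⊆ (edges q p) (unbreakableWeight p) * ∑⊆ (edges q k) (weight k)
      ≡⟨ cong₂ _*_ (R̃≡∑⊆ p) (R≡∑⊆ k) ⟨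
    R̃ q a b p * R q a b k
      ∎
    where
    open ≡-Reasoning
    p = suc j
    k = suc k′
    w = firstBreakWeight (p + k) j
    shifted = map (shiftEdge p) (edges q k)
    unbridged : ∀ s₁ → ∑[ t ⊆ bridge₁ j ∷ bridge₂ q j ∷ shifted ] w (s₁ ++ t) ≡ ∑[ t ⊆ shifted ] w (s₁ ++ t)
    unbridged s₁ =
      trans (∑⊆-∷-vanishing (bridge₁ j) (bridge₂ q j ∷ shifted) (w ∘ (s₁ ++_))
                            (λ t → firstBreakWeight-bridged (p + k) j s₁ _ t (bridge₁-crosses j)))
            (∑⊆-∷-vanishing (bridge₂ q j) shifted (w ∘ (s₁ ++_))
                            (λ t → firstBreakWeight-bridged (p + k) j s₁ _ t (bridge₂-crosses q j)))

  first-break-term : ∀ n j → j < n → ∑⊆ (edges q (suc n)) (firstBreakWeight (suc n) j) ≡ R̃ q a b (suc j) * R q a b (n ∸ j)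
  first-break-term n j j<n with k′ , refl ← m≤n⇒∃[o]m+o≡n j<n =
    subst (λ i → ∑⊆ (edges q (suc i)) (firstBreakWeight (suc i) j) ≡ R̃ q a b (suc j) * R q a b (i ∸ j)) (+-suc j k′)
      (trans (first-break-at j k′) (cong (λ i → R̃ q a b (suc j) * R q a b i) (sym (m+n∸m≡n j (suc k′)))))

  first-break-decomposition : ∀ n → R q a b (suc n) ≡ R̃ q a b (suc n) + ∑[ j ∈ upTo n ] (R̃ q a b (suc j) * R q a b (n ∸ j))
  first-break-decomposition n = begin
    R q a b (suc n)
      ≡⟨ R≡∑⊆ (suc n) ⟩
    ∑⊆ E (weight (suc n))
      ≡⟨ ∑-cong (sublists E) weight-split ⟩
    ∑[ M ⊆ E ] (unbreakableWeight (suc n) M + ∑[ j ∈ upTo n ] firstBreakWeight (suc n) j M)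
      ≡⟨ ∑-+ (sublists E) _ _ ⟩
    ∑⊆ E (unbreakableWeight (suc n)) + ∑[ M ⊆ E ] ∑[ j ∈ upTo n ] firstBreakWeight (suc n) j M
      ≡⟨ cong₂ _+_ (R̃≡∑⊆ (suc n)) (∑-comm (upTo n) (sublists E) (firstBreakWeight (suc n))) ⟨
    R̃ q a b (suc n) + ∑[ j ∈ upTo n ] ∑⊆ E (firstBreakWeight (suc n) j)
      ≡⟨ cong (R̃ q a b (suc n) +_) (∑-congᴬ (applyUpTo⁺₁ id n id) (first-break-term n _)) ⟩
    R̃ q a b (suc n) + ∑[ j ∈ upTo n ] (R̃ q a b (suc j) * R q a b (n ∸ j))
      ∎
    where
    open ≡-Reasoning
    E = edges q (suc n)
    weight-split : ∀ M → weight (suc n) M ≡ unbreakableWeight (suc n) M + ∑[ j ∈ upTo n ] firstBreakWeight (suc n) j M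
    weight-split M = begin
      weight (suc n) M
        ≡⟨ *-identityˡ _ ⟨
      1 * weight (suc n) M
        ≡⟨ cong (_* weight (suc n) M) (none-or-first (breakable M) n) ⟨
      (toℕ (unbreakable (suc n) M) + ∑[ j ∈ upTo n ] toℕ (firstAt (breakable M) j)) * weight (suc n) M
        ≡⟨ *-distribʳ-+ (weight (suc n) M) (toℕ (unbreakable (suc n) M)) _ ⟩
      unbreakableWeight (suc n) M + (∑[ j ∈ upTo n ] toℕ (firstAt (breakable M) j)) * weight (suc n) M
        ≡⟨ cong (unbreakableWeight (suc n) M +_) (∑-*ʳ (upTo n) _ _) ⟨
      unbreakableWeight (suc n) M + ∑[ j ∈ upTo n ] firstBreakWeight (suc n) j M
        ∎

  R̃₁≡R₁ : R̃ q a b 1 ≡ R q a b 1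
  R̃₁≡R₁ = trans (R̃≡∑⊆ 1) (trans (∑-cong (sublists (edges q 1)) (λ M → +-identityʳ (weight 1 M))) (sym (R≡∑⊆ 1)))

reindex-first-break : ∀ (f g : ℕ → ℕ) → f 0 ≡ 1 → g 1 ≡ f 1 →
  (∀ n → f (suc n) ≡ g (suc n) + ∑[ j ∈ upTo n ] (g (suc j) * f (n ∸ j))) →
  ∀ n → f (suc (suc n)) ≡ f (suc n) * f 1 + ∑[ k ∈ upTo (suc n) ] (f (suc n ∸ suc k) * g (suc (suc k)))
reindex-first-break f g f0≡1 g1≡f1 decomposition n = begin
  f (2 + n)
    ≡⟨ decomposition (suc n) ⟩
  g (2 + n) + ∑[ j ∈ upTo (suc n) ] (g (suc j) * f (suc n ∸ j))
    ≡⟨ cong (λ js → g (2 + n) + ∑ js (λ j → g (suc j) * f (suc n ∸ j))) (upTo-suc n) ⟩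
  g (2 + n) + (g 1 * f (suc n) + ∑ (map suc (upTo n)) (λ j → g (suc j) * f (suc n ∸ j)))
    ≡⟨ cong₂ (λ x s → g (2 + n) + (x * f (suc n) + s)) g1≡f1
             (trans (∑-map suc (upTo n) _) (∑-cong (upTo n) (λ j → *-comm (g (2 + j)) (f (n ∸ j))))) ⟩
  g (2 + n) + (f 1 * f (suc n) + ∑[ k ∈ upTo n ] h k)
    ≡⟨ rearrange (g (2 + n)) (f 1) (f (suc n)) (∑[ k ∈ upTo n ] h k) ⟩
  f (suc n) * f 1 + (∑[ k ∈ upTo n ] h k + (1 * g (2 + n) + 0))
    ≡⟨ cong (λ x → f (suc n) * f 1 + (∑[ k ∈ upTo n ] h k + (x * g (2 + n) + 0))) (trans (cong f (n∸n≡0 n)) f0≡1) ⟨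
  f (suc n) * f 1 + (∑[ k ∈ upTo n ] h k + (h n + 0))
    ≡⟨ cong (f (suc n) * f 1 +_) (∑-++ (upTo n) [ n ] h) ⟨
  f (suc n) * f 1 + ∑ (upTo n ∷ʳ n) h
    ≡⟨ cong (λ ks → f (suc n) * f 1 + ∑ ks h) (upTo-∷ʳ n) ⟩
  f (suc n) * f 1 + ∑[ k ∈ upTo (suc n) ] h k
    ∎
  where
  open ≡-Reasoning
  h : ℕ → ℕ
  h k = f (n ∸ k) * g (2 + k)
  rearrange : ∀ x y z s → x + (y * z + s) ≡ z * y + (s + (1 * x + 0))
  rearrange = solve-∀

mainTheorem8 : (q a b : ℕ) → 4 ≤ q → 1 ≤ a → 1 ≤ b → (n : ℕ) → 1 ≤ n →
    R q a b (suc n) ≡ R q a b n * R q a b 1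
    + sum (map (λ k → R q a b (n ∸ suc k) * R̃ q a b (suc (suc k))) (upTo n))
mainTheorem8 q a b 4≤q _ _ (suc n) _ = reindex-first-break (R q a b) (R̃ q a b) refl R̃₁≡R₁ first-break-decomposition n
  where open Weights q a b (∸-monoˡ-≤ 3 4≤q)
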